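{- Fix $r\in\mathbb{N}$ and let $\mathcal{A}$ and $\mathcal{B}$ be two sets of finite $\tau$-structures. The following are equivalent: (a) Duplicator wins the $r$-round MS game on $(\mathcal{A},\mathcal{B})$; (b) Duplicator wins the $r$-round MS game without duplicating on $(\mathcal{A}^+,\mathcal{B}^+)$, where $\mathcal{A}^+$ is the multiset consisting of $|A|^r$ copies of each $\mathbf{A}\in\mathcal{A}$ (with $A$ the universe of $\mathbf{A}$) and $\mathcal{B}^+$ is the multiset consisting of $|B|^r$ copies of each $\mathbf{B}\in\mathcal{B}$.
   Context: Fix a schema $\tau$ with finitely many relation and constant symbols. A pebbled structure $\langle \mathbf{A} \mid a_1,\dots,a_t\rangle$ is a $\tau$-structure with elements $a_1,\dots,a_t$ (not necessarily distinct), $a_i$ carrying pebble color $i$. Two pebbled structures $\langle \mathbf{A}\mid a_1,\dots,a_t\rangle$, $\langle \mathbf{B}\mid b_1,\dots,b_t\rangle$ form a matching pair if the map $a_i\mapsto b_i$, $c^{\mathbf{A}}\mapsto c^{\mathbf{B}}$ (for constant symbols $c$) is an isomorphism between the substructures induced by its domain and range. The $r$-round MS game on $(\mathcal{A},\mathcal{B})$: start at $(\mathcal{A}_0,\mathcal{B}_0)=(\mathcal{A},\mathcal{B})$; if no left/right matching pair exists, Spoiler wins. In round $t=1,\dots,r$ Spoiler chooses a side, say left (right is symmetric), and places pebble $t$ on an element of each pebbled structure in $\mathcal{A}_{t-1}$, giving $\mathcal{A}_t$; Duplicator, for each pebbled structure in $\mathcal{B}_{t-1}$, may make any number of copies and places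 pebble $t$ on an element of each copy, giving $\mathcal{B}_t$. If no member of $\mathcal{A}_t$ forms a matching pair with a member of $\mathcal{B}_t$, Spoiler wins. Duplicator wins if a matching pair remains after round $r$. The game "without duplicating" on multisets is the same game except that Duplicator may not make copies: she places exactly one pebble on each (copy of a) pebbled structure on her side. "Wins" means has a winning strategy. -}

module Defs where

open import Data.Nat using (ℕ; zero; suc; _^_; NonZero)
open import Data.Fin using (Fin)
open import Data.Vec using (Vec; []; _∷ʳ_; lookup; map)
open import Data.Bool using (Bool)
open import Data.Sum using (_⊎_; inj₁; inj₂)
open import Data.Product using (Σ; _×_; _,_; proj₁; proj₂; Σ-syntax)
open import Relation.Binary.PropositionalEquality using (_≡_; subst)
open import Function.Bundles using (_⇔_)

record Schema : Set where
  field
    nRel  : ℕ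
    arity : Fin nRel → ℕ
    nConst : ℕ

open Schema public

-- Finite τ-structures.  The universe is Fin size (nonempty, as usual
-- in model theory); relations are given by their (decidable, since
-- finite) characteristic functions.

record Structure (τ : Schema) : Set where
  field
    size     : ℕ
    nonempty : NonZero size
    rel      : (R : Fin (nRel τ)) → Vec (Fin size) (arity τ R) → Bool
    const    : Fin (nConst τ) → Fin size

open Structure public

SameStructure : {τ : Schema} → Structure τ → Structure τ → Set
SameStructure {τ} A B =
  Σ[ p ∈ size A ≡ size B ]
    ((∀ (R : Fin (nRel τ)) (v : Vec (Fin (size A)) (arity τ R)) →
        rel A R v ≡ rel B R (map (subst Fin p) v))
    × (∀ (c : Fin (nConst τ)) → subst Fin p (const A c) ≡ const B c))

-- A family of structures indexed by I, representing a set of structures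
-- (no two indices carry the same structure).
IsSet : {τ : Schema} {I : Set} → (I → Structure τ) → Set
IsSet {I = I} 𝒜 = ∀ (i j : I) → SameStructure (𝒜 i) (𝒜 j) → i ≡ j

-- Pebbled structures ⟨ A | a₁ … a_t ⟩ ; pebble i sits on lookup peb i.

record Pebbled (τ : Schema) (t : ℕ) : Set where
  field
    struct : Structure τ
    peb    : Vec (Fin (size struct)) t

open Pebbled public

place : {τ : Schema} {t : ℕ} (P : Pebbled τ t) → Fin (size (struct P)) → Pebbled τ (suc t)
place P x = record { struct = struct P ; peb = peb P ∷ʳ x }

unpebbled : {τ : Schema} → Structure τ → Pebbled τ zero
unpebbled A = record { struct = A ; peb = [] }

-- Points of the domain of the map a_i ↦ b_i, c^A ↦ c^B : a pebble colour
-- or a constant symbol.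
Term : Schema → ℕ → Set
Term τ t = Fin t ⊎ Fin (nConst τ)

eval : {τ : Schema} {t : ℕ} (P : Pebbled τ t) → Term τ t → Fin (size (struct P))
eval P (inj₁ i) = lookup (peb P) i
eval P (inj₂ c) = const (struct P) c

-- Matching pair: the map a_i ↦ b_i, c^A ↦ c^B is a well-defined bijection
-- between its domain and range which preserves and reflects all relations,
-- i.e. an isomorphism of the induced substructures.
Matching : {τ : Schema} {t : ℕ} → Pebbled τ t → Pebbled τ t → Set
Matching {τ} {t} P Q =
  (∀ (s s' : Term τ t) → (eval P s ≡ eval P s') ⇔ (eval Q s ≡ eval Q s'))
  × (∀ (R : Fin (nRel τ)) (ss : Vec (Term τ t) (arity τ R)) →
       rel (struct P) R (map (eval P) ss) ≡ rel (struct Q) R (map (eval Q) ss))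

-- Game positions: (multi)sets of pebbled structures, as indexed families.

record Side (τ : Schema) (t : ℕ) : Set₁ where
  field
    Idx : Set
    pos : Idx → Pebbled τ t

open Side public

HasMatch : {τ : Schema} {t : ℕ} → Side τ t → Side τ t → Set
HasMatch L R = Σ[ i ∈ Idx L ] Σ[ j ∈ Idx R ] Matching (pos L i) (pos R j)

SpoilerMove : {τ : Schema} {t : ℕ} → Side τ t → Set
SpoilerMove S = (i : Idx S) → Fin (size (struct (pos S i)))

applySpoiler : {τ : Schema} {t : ℕ} (S : Side τ t) → SpoilerMove S → Side τ (suc t)
applySpoiler S σ = record { Idx = Idx S ; pos = λ i → place (pos S i) (σ i) }

DupMove : {τ : Schema} {t : ℕ} → Side τ t → Set
DupMove S = Σ[ k ∈ (Idx S → ℕ) ] ((j : Idx S) → Fin (k j) → Fin (size (struct (pos S j))))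

applyDup : {τ : Schema} {t : ℕ} (S : Side τ t) → DupMove S → Side τ (suc t)
applyDup S (k , ρ) = record
  { Idx = Σ[ j ∈ Idx S ] Fin (k j)
  ; pos = λ jc → place (pos S (proj₁ jc)) (ρ (proj₁ jc) (proj₂ jc)) }

DuplicatorWins : {τ : Schema} {t : ℕ} (n : ℕ) → Side τ t → Side τ t → Set
DuplicatorWins zero L R = HasMatch L R
DuplicatorWins (suc n) L R =
  HasMatch L R
  × (∀ (σ : SpoilerMove L) → Σ[ δ ∈ DupMove R ]
        DuplicatorWins n (applySpoiler L σ) (applyDup R δ))
  × (∀ (σ : SpoilerMove R) → Σ[ δ ∈ DupMove L ]
        DuplicatorWins n (applyDup L δ) (applySpoiler R σ))

DuplicatorWinsND : {τ : Schema} {t : ℕ} (n : ℕ) → Side τ t → Side τ t → Set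
DuplicatorWinsND zero L R = HasMatch L R
DuplicatorWinsND (suc n) L R =
  HasMatch L R
  × (∀ (σ : SpoilerMove L) → Σ[ δ ∈ SpoilerMove R ]
        DuplicatorWinsND n (applySpoiler L σ) (applySpoiler R δ))
  × (∀ (σ : SpoilerMove R) → Σ[ δ ∈ SpoilerMove L ]
        DuplicatorWinsND n (applySpoiler L δ) (applySpoiler R σ))

initial : {τ : Schema} {I : Set} → (I → Structure τ) → Side τ zero
initial {I = I} 𝒜 = record { Idx = I ; pos = λ i → unpebbled (𝒜 i) }

plus : {τ : Schema} {I : Set} → ℕ → (I → Structure τ) → Side τ zero
plus {I = I} r 𝒜 = record
  { Idx = Σ[ i ∈ I ] Fin (size (𝒜 i) ^ r)
  ; pos = λ ic → unpebbled (𝒜 (proj₁ ic)) }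

-- Duplicator loses nothing by answering every move with the full reply: one copy of each
-- pebbled structure for every element, pebbled with that element; any other reply, with or
-- without duplicating, is a sub-multiset of it, and winning is monotone under inclusion.
-- Conversely, full replies can be simulated without duplicating once every structure A is
-- present |A|^n times with n rounds left.  When Spoiler pebbles the |A|^(n+1) copies of A, by
-- pigeonhole some element x is pebbled on |A|^n of them, so this is the simulated Spoiler
-- pebbling x on A.  On her side Duplicator pebbles the |B|^(n+1) copies of B so that every
-- element of B is pebbled on |B|^n of them: |B|^n copies of each structure of the full reply.
module Submission where

open import Defs
open import Data.Nat using (ℕ; zero; suc; _+_; _*_; _^_; _≤_; NonZero; s≤s⁻¹)
open import Data.Nat.Properties
  using (+-0-commutativeMonoid; +-cancelˡ-≤; +-monoˡ-≤; +-identityʳ; ≤-trans; ≤-reflexive; ≰⇒≥;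
         _≤?_; m^n≢0)
open import Data.Fin using (Fin; zero; suc; combine; remQuot)
open import Data.Fin.Properties using (_≟_; suc-injective; any?; remQuot-combine; combine-remQuot)
open import Data.Bool using (if_then_else_)
open import Data.Maybe using (Maybe; just; nothing; _>>=_)
import Data.Maybe as Maybe
open import Data.Product using (Σ; Σ-syntax; ∃; ∃-syntax; _×_; _,_; proj₁; proj₂; map; map₂)
open import Data.Empty using (⊥-elim)
open import Function using (_∘_; id; Injective)
open import Function.Bundles using (_⇔_; mk⇔)
open import Level using (0ℓ)
open import Relation.Unary using (Pred; Decidable)
open import Relation.Nullary using (Dec; does; yes; no)
open import Relation.Binary.PropositionalEquality
open import Algebra.Properties.CommutativeMonoid.Sum +-0-commutativeMonoid
  using (sum-syntax; ∑-distrib-+; sum-replicate-zero)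

-- An injection with a partial inverse: the index sets of game positions need not have
-- decidable equality, so the inverse cannot be computed from injectivity alone.
record Embedding (A B : Set) : Set where
  field
    to      : A → B
    from    : B → Maybe A
    from-to : ∀ a → from (to a) ≡ just a
    to-from : ∀ {b a} → from b ≡ just a → to a ≡ b

open Embedding

id-embedding : ∀ {A} → Embedding A A
id-embedding = record { to = id ; from = just ; from-to = λ _ → refl ; to-from = λ { refl → refl } }

_∘ᴱ_ : ∀ {A B C} → Embedding B C → Embedding A B → Embedding A C
_∘ᴱ_ {B = B} g f = record
  { to = to g ∘ to f
  ; from = λ c → from g c >>= from f
  ; from-to = λ a → trans (cong (_>>= from f) (from-to g (to f a))) (from-to f a)
  ; to-from = λ {c} → bind-to-from (from g c) (to-from g) }
  where
  bind-to-from : ∀ {c a} (m : Maybe B) → (∀ {b} → m ≡ just b → to g b ≡ c) →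
                 (m >>= from f) ≡ just a → to g (to f a) ≡ c
  bind-to-from (just b) g-to-from e = trans (cong (to g) (to-from f e)) (g-to-from refl)

Σ-embedding : ∀ {I : Set} {B C : I → Set} →
              (∀ i → Embedding (B i) (C i)) → Embedding (Σ I B) (Σ I C)
Σ-embedding {B = B} {C} e = record
  { to = λ (i , b) → i , to (e i) b
  ; from = λ (i , c) → Maybe.map (i ,_) (from (e i) c)
  ; from-to = λ (i , b) → cong (Maybe.map (i ,_)) (from-to (e i) b)
  ; to-from = λ {(i , c)} → map-to-from i {c} (from (e i) c) (to-from (e i)) }
  where
  map-to-from : ∀ i {c : C i} {a} (m : Maybe (B i)) →
                (∀ {b} → m ≡ just b → to (e i) b ≡ c) →
                Maybe.map (i ,_) m ≡ just a → (proj₁ a , to (e (proj₁ a)) (proj₂ a)) ≡ (i , c)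
  map-to-from i (just b) e-to-from refl = cong (i ,_) (e-to-from refl)

combine-embedding : ∀ {I : Set} (m k : I → ℕ) →
                    Embedding (Σ[ (i , _) ∈ Σ I (Fin ∘ m) ] Fin (k i)) (Σ[ i ∈ I ] Fin (m i * k i))
combine-embedding m k = record
  { to = λ ((i , x) , y) → i , combine x y
  ; from = λ (i , c) → let x , y = remQuot {m i} (k i) c in just ((i , x) , y)
  ; from-to = λ ((i , x) , y) → cong (λ (x , y) → just ((i , x) , y)) (remQuot-combine x y)
  ; to-from = λ { {i , c} refl → cong (i ,_) (combine-remQuot {m i} (k i) c) } }

injective⇒embedding : ∀ {q M} (g : Fin q → Fin M) →
                      Injective _≡_ _≡_ g → Embedding (Fin q) (Fin M)
injective⇒embedding {q} g g-injective = record
  { to = g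
  ; from = λ c → preimage (any? λ k → g k ≟ c)
  ; from-to = λ a → preimage-to (any? λ k → g k ≟ g a)
  ; to-from = λ {c} → to-preimage (any? λ k → g k ≟ c) }
  where
  preimage : ∀ {c} → Dec (∃ λ k → g k ≡ c) → Maybe (Fin q)
  preimage (yes (k , _)) = just k
  preimage (no _) = nothing
  preimage-to : ∀ {a} (d : Dec (∃ λ k → g k ≡ g a)) → preimage d ≡ just a
  preimage-to (yes (k , gk≡ga)) = cong just (g-injective gk≡ga)
  preimage-to {a} (no ∄) = ⊥-elim (∄ (a , refl))
  to-preimage : ∀ {c a} (d : Dec (∃ λ k → g k ≡ c)) → preimage d ≡ just a → g a ≡ c
  to-preimage (yes (_ , gk≡c)) refl = gk≡c

count : ∀ {M} {P : Pred (Fin M) 0ℓ} → Decidable P → ℕ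
count {zero} P? = 0
count {suc M} P? = (if does (P? zero) then 1 else 0) + count (P? ∘ suc)

record AtLeast {M : ℕ} (q : ℕ) (P : Pred (Fin M) 0ℓ) : Set where
  field
    select : Fin q → Fin M
    select-injective : Injective _≡_ _≡_ select
    select-∈ : ∀ k → P (select k)

open AtLeast

atLeast-zero : ∀ {M} {P : Pred (Fin M) 0ℓ} → AtLeast 0 P
atLeast-zero = record { select = λ () ; select-injective = λ {} ; select-∈ = λ () }

atLeast-suc : ∀ {M q} {P : Pred (Fin (suc M)) 0ℓ} → AtLeast q (P ∘ suc) → AtLeast q P
atLeast-suc A = record
  { select = suc ∘ select A
  ; select-injective = select-injective A ∘ suc-injective
  ; select-∈ = select-∈ A }

atLeast-∷ : ∀ {M q} {P : Pred (Fin (suc M)) 0ℓ} →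
            P zero → AtLeast q (P ∘ suc) → AtLeast (suc q) P
atLeast-∷ {P = P} p A = record
  { select = cons ; select-injective = cons-injective ; select-∈ = cons-∈ }
  where
  cons : Fin _ → Fin _
  cons zero = zero
  cons (suc k) = suc (select A k)
  cons-injective : Injective _≡_ _≡_ cons
  cons-injective {zero} {zero} _ = refl
  cons-injective {zero} {suc _} ()
  cons-injective {suc _} {zero} ()
  cons-injective {suc k} {suc l} e = cong suc (select-injective A (suc-injective e))
  cons-∈ : ∀ k → P (cons k)
  cons-∈ zero = p
  cons-∈ (suc k) = select-∈ A k

count⇒atLeast : ∀ {M q} {P : Pred (Fin M) 0ℓ} (P? : Decidable P) →
                q ≤ count P? → AtLeast q P
count⇒atLeast {zero} {zero} P? _ = atLeast-zero
count⇒atLeast {suc M} {q} P? q≤ with P? zero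
... | no _ = atLeast-suc (count⇒atLeast (P? ∘ suc) q≤)
count⇒atLeast {suc M} {zero} P? q≤ | yes _ = atLeast-zero
count⇒atLeast {suc M} {suc q} P? q≤ | yes p =
  atLeast-∷ p (count⇒atLeast (P? ∘ suc) (s≤s⁻¹ q≤))

∑-indicator : ∀ {s} (y : Fin s) → ∑[ x < s ] (if does (y ≟ x) then 1 else 0) ≡ 1
∑-indicator {suc s} zero = cong suc (sum-replicate-zero s)
∑-indicator (suc y) = ∑-indicator y

∑-fibre-sizes : ∀ {M s} (f : Fin M → Fin s) → ∑[ x < s ] count (λ c → f c ≟ x) ≡ M
∑-fibre-sizes {zero} {s} f = sum-replicate-zero s
∑-fibre-sizes {suc M} {s} f = begin
  ∑[ x < s ] (indicator x + count (λ c → f (suc c) ≟ x))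
    ≡⟨ ∑-distrib-+ {s} indicator _ ⟩
  ∑[ x < s ] indicator x + ∑[ x < s ] count (λ c → f (suc c) ≟ x)
    ≡⟨ cong₂ _+_ (∑-indicator (f zero)) (∑-fibre-sizes (f ∘ suc)) ⟩
  suc M ∎
  where
  open ≡-Reasoning
  indicator : Fin s → ℕ
  indicator x = if does (f zero ≟ x) then 1 else 0

∑-averaging : ∀ s q (C : Fin (suc s) → ℕ) →
              suc s * q ≤ ∑[ x < suc s ] C x → ∃[ x ] q ≤ C x
∑-averaging zero q C le = zero , subst₂ _≤_ (+-identityʳ q) (+-identityʳ (C zero)) le
∑-averaging (suc s) q C le with q ≤? C zero
... | yes q≤C₀ = zero , q≤C₀
... | no q≰C₀ = map suc id (∑-averaging s q (C ∘ suc) rest-large)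
  where
  rest-large : suc s * q ≤ ∑[ x < suc s ] C (suc x)
  rest-large = +-cancelˡ-≤ (C zero) _ _ (≤-trans (+-monoˡ-≤ _ (≰⇒≥ q≰C₀)) le)

pigeonhole : ∀ {s} q .{{_ : NonZero s}} (f : Fin (s * q) → Fin s) →
             ∃[ x ] AtLeast q (λ c → f c ≡ x)
pigeonhole {suc s} q f = map₂ (λ {x} → count⇒atLeast (λ c → f c ≟ x)) large-fibre
  where
  large-fibre : ∃[ x ] q ≤ count (λ c → f c ≟ x)
  large-fibre = ∑-averaging s q _ (≤-reflexive (sym (∑-fibre-sizes f)))

someIndex : ∀ {n} → NonZero n → Fin n
someIndex {suc n} _ = zero

module _ {τ : Schema} where

  Point : ∀ {t} → Pebbled τ t → Set
  Point P = Fin (size (struct P))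

  sizeAt : ∀ {t} (S : Side τ t) → Idx S → ℕ
  sizeAt S i = size (struct (pos S i))

  place-cong : ∀ {t} {P Q : Pebbled τ t} {x y} (P≡Q : P ≡ Q) →
               subst Point P≡Q x ≡ y → place P x ≡ place Q y
  place-cong refl refl = refl

  _⊑_ : ∀ {t} → Side τ t → Side τ t → Set
  S ⊑ S' = (i : Idx S) → Σ[ i' ∈ Idx S' ] pos S i ≡ pos S' i'

  ⊑-refl : ∀ {t} {S : Side τ t} → S ⊑ S
  ⊑-refl i = i , refl

  HasMatch-mono : ∀ {t} {L R L' R' : Side τ t} → HasMatch L R → L ⊑ L' → R ⊑ R' → HasMatch L' R'
  HasMatch-mono (i , j , m) L⊑L' R⊑R' with i' , eᵢ ← L⊑L' i | j' , eⱼ ← R⊑R' j =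
    i' , j' , subst₂ Matching eᵢ eⱼ m

  restrictMove : ∀ {t} {S S' : Side τ t} → S ⊑ S' → SpoilerMove S' → SpoilerMove S
  restrictMove S⊑S' σ' i with i' , e ← S⊑S' i = subst Point (sym e) (σ' i')

  applySpoiler-restrict-⊑ : ∀ {t} {S S' : Side τ t} (S⊑S' : S ⊑ S') (σ' : SpoilerMove S') →
                            applySpoiler S (restrictMove S⊑S' σ') ⊑ applySpoiler S' σ'
  applySpoiler-restrict-⊑ S⊑S' σ' i with i' , e ← S⊑S' i = i' , place-cong e (subst-subst-sym e)

  fullMove : ∀ {t} (S : Side τ t) → DupMove S
  fullMove S = sizeAt S , λ _ x → x

  full : ∀ {t} → Side τ t → Side τ (suc t)
  full S = applyDup S (fullMove S)

  full-⊑ : ∀ {t} {S S' : Side τ t} → S ⊑ S' → full S ⊑ full S'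
  full-⊑ S⊑S' (i , x) with i' , e ← S⊑S' i = (i' , subst Point e x) , place-cong e refl

  applyDup-⊑-full : ∀ {t} (S : Side τ t) (δ : DupMove S) → applyDup S δ ⊑ full S
  applyDup-⊑-full S (k , ρ) (i , c) = (i , ρ i c) , refl

  applySpoiler-⊑-full : ∀ {t} (S : Side τ t) (σ : SpoilerMove S) → applySpoiler S σ ⊑ full S
  applySpoiler-⊑-full S σ i = (i , σ i) , refl

  DuplicatorWinsFull : ∀ {t} (n : ℕ) → Side τ t → Side τ t → Set
  DuplicatorWinsFull zero L R = HasMatch L R
  DuplicatorWinsFull (suc n) L R =
    HasMatch L R
    × (∀ (σ : SpoilerMove L) → DuplicatorWinsFull n (applySpoiler L σ) (full R))
    × (∀ (σ : SpoilerMove R) → DuplicatorWinsFull n (full L) (applySpoiler R σ))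

  DuplicatorWinsFull-mono : ∀ n {t} {L R L' R' : Side τ t} →
                            DuplicatorWinsFull n L R → L ⊑ L' → R ⊑ R' → DuplicatorWinsFull n L' R'
  DuplicatorWinsFull-mono zero w L⊑L' R⊑R' = HasMatch-mono w L⊑L' R⊑R'
  DuplicatorWinsFull-mono (suc n) (m , wˡ , wʳ) L⊑L' R⊑R' =
    HasMatch-mono m L⊑L' R⊑R'
    , (λ σ' → DuplicatorWinsFull-mono n (wˡ (restrictMove L⊑L' σ'))
                (applySpoiler-restrict-⊑ L⊑L' σ') (full-⊑ R⊑R'))
    , (λ σ' → DuplicatorWinsFull-mono n (wʳ (restrictMove R⊑R' σ'))
                (full-⊑ L⊑L') (applySpoiler-restrict-⊑ R⊑R' σ'))

  DuplicatorWins⇒Full : ∀ n {t} {L R : Side τ t} →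
                        DuplicatorWins n L R → DuplicatorWinsFull n L R
  DuplicatorWins⇒Full zero w = w
  DuplicatorWins⇒Full (suc n) {L = L} {R} (m , wˡ , wʳ) = m
    , (λ σ → let δ , w = wˡ σ in
             DuplicatorWinsFull-mono n (DuplicatorWins⇒Full n w) ⊑-refl (applyDup-⊑-full R δ))
    , (λ σ → let δ , w = wʳ σ in
             DuplicatorWinsFull-mono n (DuplicatorWins⇒Full n w) (applyDup-⊑-full L δ) ⊑-refl)

  Full⇒DuplicatorWins : ∀ n {t} {L R : Side τ t} →
                        DuplicatorWinsFull n L R → DuplicatorWins n L R
  Full⇒DuplicatorWins zero w = w
  Full⇒DuplicatorWins (suc n) {L = L} {R} (m , wˡ , wʳ) = m
    , (λ σ → fullMove R , Full⇒DuplicatorWins n (wˡ σ))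
    , (λ σ → fullMove L , Full⇒DuplicatorWins n (wʳ σ))

  DuplicatorWinsND⇒Full : ∀ n {t} {L R : Side τ t} →
                          DuplicatorWinsND n L R → DuplicatorWinsFull n L R
  DuplicatorWinsND⇒Full zero w = w
  DuplicatorWinsND⇒Full (suc n) {L = L} {R} (m , wˡ , wʳ) = m
    , (λ σ → let δ , w = wˡ σ in
             DuplicatorWinsFull-mono n (DuplicatorWinsND⇒Full n w) ⊑-refl (applySpoiler-⊑-full R δ))
    , (λ σ → let δ , w = wʳ σ in
             DuplicatorWinsFull-mono n (DuplicatorWinsND⇒Full n w) (applySpoiler-⊑-full L δ) ⊑-refl)

  record Copies {t} (n : ℕ) (S S' : Side τ t) : Set where
    field
      copy     : Embedding (Σ[ i ∈ Idx S ] Fin (sizeAt S i ^ n)) (Idx S')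
      pos-copy : ∀ a → pos S' (to copy a) ≡ pos S (proj₁ a)

    pos-from : ∀ {i' a} → from copy i' ≡ just a → pos S' i' ≡ pos S (proj₁ a)
    pos-from e = trans (cong (pos S') (sym (to-from copy e))) (pos-copy _)

    Copies⇒⊑ : S ⊑ S'
    Copies⇒⊑ i = to copy (i , firstCopy) , sym (pos-copy _)
      where
      firstCopy : Fin (sizeAt S i ^ n)
      firstCopy = someIndex (m^n≢0 (sizeAt S i) n {{nonempty (struct (pos S i))}})

  open Copies

  module SpoilerReply {t n} {S S' : Side τ t} (C : Copies (suc n) S S') (σ' : SpoilerMove S') where

    chosen : (i : Idx S) → Fin (sizeAt S i ^ suc n) → Point (pos S i)
    chosen i c = subst Point (pos-copy C (i , c)) (σ' (to (copy C) (i , c)))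

    majority : (i : Idx S) → ∃[ x ] AtLeast (sizeAt S i ^ n) (λ c → chosen i c ≡ x)
    majority i = pigeonhole (sizeAt S i ^ n) {{nonempty (struct (pos S i))}} (chosen i)

    σ : SpoilerMove S
    σ i = proj₁ (majority i)

    majority-copies : (i : Idx S) → Embedding (Fin (sizeAt S i ^ n)) (Fin (sizeAt S i ^ suc n))
    majority-copies i = injective⇒embedding (select A) (select-injective A)
      where A = proj₂ (majority i)

    copies : Copies n (applySpoiler S σ) (applySpoiler S' σ')
    copies = record
      { copy = copy C ∘ᴱ Σ-embedding majority-copies
      ; pos-copy = λ (i , k) → place-cong (pos-copy C _) (select-∈ (proj₂ (majority i)) k) }

  module DuplicatorReply {t n} {S S' : Side τ t} (C : Copies (suc n) S S') where

    Label : Set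
    Label = Σ[ i ∈ Idx S ] Fin (sizeAt S i ^ suc n)

    PosAgrees : Idx S' → Maybe Label → Set
    PosAgrees i' m = ∀ {a} → m ≡ just a → pos S' i' ≡ pos S (proj₁ a)

    answer : (i' : Idx S') (m : Maybe Label) → PosAgrees i' m → Point (pos S' i')
    answer i' nothing _ = someIndex (nonempty (struct (pos S' i')))
    answer i' (just (i , c)) e = subst Point (sym (e refl)) (proj₁ (remQuot (sizeAt S i ^ n) c))

    answer-place : ∀ i' m (e : PosAgrees i' m) {i c} → m ≡ just (i , c) →
                   place (pos S' i') (answer i' m e) ≡ place (pos S i) (proj₁ (remQuot (sizeAt S i ^ n) c))
    answer-place i' (just _) e refl = place-cong (e refl) (subst-subst-sym (e refl))

    -- The copy labelled (i , combine x k) gets pebble x.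
    δ : SpoilerMove S'
    δ i' = answer i' (from (copy C) i') (pos-from C)

    copies : Copies n (full S) (applySpoiler S' δ)
    copies = record
      { copy = copy C ∘ᴱ combine-embedding (sizeAt S) (λ i → sizeAt S i ^ n)
      ; pos-copy = λ ((i , x) , k) →
          trans (answer-place _ _ _ (from-to (copy C) (i , combine x k)))
                (cong (place (pos S i) ∘ proj₁) (remQuot-combine x k)) }

  Full⇒DuplicatorWinsND : ∀ n {t} {L R L' R' : Side τ t} → DuplicatorWinsFull n L R →
                          Copies n L L' → Copies n R R' → DuplicatorWinsND n L' R'
  Full⇒DuplicatorWinsND zero w Cˡ Cʳ = HasMatch-mono w (Copies⇒⊑ Cˡ) (Copies⇒⊑ Cʳ)
  Full⇒DuplicatorWinsND (suc n) (m , wˡ , wʳ) Cˡ Cʳ =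
    HasMatch-mono m (Copies⇒⊑ Cˡ) (Copies⇒⊑ Cʳ)
    , (λ σ' → let open SpoilerReply Cˡ σ' in
              DuplicatorReply.δ Cʳ , Full⇒DuplicatorWinsND n (wˡ σ) copies (DuplicatorReply.copies Cʳ))
    , (λ σ' → let open SpoilerReply Cʳ σ' in
              DuplicatorReply.δ Cˡ , Full⇒DuplicatorWinsND n (wʳ σ) (DuplicatorReply.copies Cˡ) copies)

  plus-copies : ∀ r {I : Set} (𝒜 : I → Structure τ) → Copies r (initial 𝒜) (plus r 𝒜)
  plus-copies r 𝒜 = record { copy = id-embedding ; pos-copy = λ _ → refl }

  plus-⊑ : ∀ r {I : Set} (𝒜 : I → Structure τ) → plus r 𝒜 ⊑ initial 𝒜
  plus-⊑ r 𝒜 (i , _) = i , refl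

theorem3p5 : (τ : Schema) (r : ℕ) (I J : Set)
    (𝒜 : I → Structure τ) (ℬ : J → Structure τ) →
    IsSet 𝒜 → IsSet ℬ →
    DuplicatorWins r (initial 𝒜) (initial ℬ) ⇔ DuplicatorWinsND r (plus r 𝒜) (plus r ℬ)
theorem3p5 τ r I J 𝒜 ℬ _ _ = mk⇔
  (λ w → Full⇒DuplicatorWinsND r (DuplicatorWins⇒Full r w) (plus-copies r 𝒜) (plus-copies r ℬ))
  (λ w → Full⇒DuplicatorWins r
           (DuplicatorWinsFull-mono r (DuplicatorWinsND⇒Full r w) (plus-⊑ r 𝒜) (plus-⊑ r ℬ)))
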